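{- Let $\mathbb{F}$ be a field with $q$ elements, let $T$ be a nonempty subset of $\mathbb{F}^n$ and $r=a(T)$ its algebraic complexity. Let $P_1,\dots,P_m\in\mathbb{F}[x_1,\dots,x_n]$ be polynomials such that $T\subseteq\bigcap_{i=1}^m\mathcal{Z}(P_i)$ and $$\sum_{i=1}^m\deg(P_i)<n-\frac{r}{q-1}.$$ Then the $P_i$ have a common zero in $\mathbb{F}^n\setminus T$.
   Context: For $f\in\mathbb{F}[x_1,\dots,x_n]$, $\mathcal{Z}(f)=\{a\in\mathbb{F}^n:f(a)=0\}$. Algebraic complexity: for a finite set $T\subseteq\mathbb{F}^n$ with $|T|>1$, $a(T)=\min\{\deg(g): g\in\mathbb{F}[x_1,\dots,x_n],\ |\mathcal{Z}(g)\cap T|=|T|-1\}$; if $|T|=1$, $a(T)=0$. -}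

module Defs where

open import Level using (0ℓ)
open import Data.Nat as ℕ using (ℕ; zero; suc; _<_; _≤_; _∸_)
open import Data.Fin using (Fin)
open import Data.Fin.Properties using () renaming (_≟_ to _≟ᶠ_)
open import Data.Vec using (Vec; []; _∷_)
open import Data.Vec.Properties using (≡-dec)
open import Data.List using (List; []; _∷_; length; filter; map; allFin)
open import Data.Nat.ListAction using (sum)
open import Data.Product using (Σ; ∃; _×_; _,_; proj₁; proj₂)
open import Data.Sum using (_⊎_)
open import Relation.Nullary using (¬_; Dec; yes; no)
open import Relation.Binary.PropositionalEquality using (_≡_; _≢_)
open import Algebra.Structures using (IsCommutativeRing)

-- A field with q elements.  Up to isomorphism every field with q
-- elements has carrier Fin q, with equality the propositional one.

record FiniteField (q : ℕ) : Set where
  field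
    _+_ _*_ : Fin q → Fin q → Fin q
    -_      : Fin q → Fin q
    0# 1#   : Fin q
    isCommutativeRing : IsCommutativeRing _≡_ _+_ _*_ -_ 0# 1#
    0≢1     : 0# ≢ 1#
    inverse : ∀ x → x ≢ 0# → ∃ λ y → x * y ≡ 1#

module Poly {q : ℕ} (F : FiniteField q) where
  open FiniteField F

  Point : ℕ → Set
  Point n = Vec (Fin q) n

  _≟_ : (x y : Fin q) → Dec (x ≡ y)
  _≟_ = _≟ᶠ_

  Exps : ℕ → Set
  Exps n = Vec ℕ n

  totalDeg : ∀ {n} → Exps n → ℕ
  totalDeg []       = 0
  totalDeg (e ∷ es) = e ℕ.+ totalDeg es

  -- A polynomial in F[x_1,…,x_n], represented as a finite formal sum
  -- of terms  c · x_1^{e_1} ⋯ x_n^{e_n}  (a list of (c , e) pairs).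
  Polynomial : ℕ → Set
  Polynomial n = List (Fin q × Exps n)

  coeff : ∀ {n} → Polynomial n → Exps n → Fin q
  coeff []             e = 0#
  coeff ((c , e′) ∷ P) e with ≡-dec ℕ._≟_ e′ e
  ... | yes _ = c + coeff P e
  ... | no  _ = coeff P e

  pow : Fin q → ℕ → Fin q
  pow x zero    = 1#
  pow x (suc k) = x * pow x k

  evalMono : ∀ {n} → Exps n → Point n → Fin q
  evalMono []       []       = 1#
  evalMono (e ∷ es) (a ∷ as) = pow a e * evalMono es as

  eval : ∀ {n} → Polynomial n → Point n → Fin q
  eval []            a = 0#
  eval ((c , e) ∷ P) a = (c * evalMono e a) + eval P a

  -- deg P ≡ d : all monomials of total degree > d have zero coefficient,
  -- and some monomial of total degree d has nonzero coefficient
  -- (convention: the zero polynomial has degree 0).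
  IsDeg : ∀ {n} → Polynomial n → ℕ → Set
  IsDeg {n} P d =
    (∀ (e : Exps n) → d < totalDeg e → coeff P e ≡ 0#) ×
    (d ≡ 0 ⊎ Σ (Exps n) λ e → totalDeg e ≡ d × coeff P e ≢ 0#)

  -- a finite subset T of F^n: a duplicate-free list of points;
  -- |T| = length T.
  -- |Z(g) ∩ T|
  zerosIn : ∀ {n} → Polynomial n → List (Point n) → ℕ
  zerosIn g T = length (filter (λ a → eval g a ≟ 0#) T)

  Separates : ∀ {n} → List (Point n) → Polynomial n → Set
  Separates T g = zerosIn g T ≡ length T ∸ 1

  IsAlgComplexity : ∀ {n} → List (Point n) → ℕ → Set
  IsAlgComplexity {n} T r =
    (length T ≡ 1 × r ≡ 0) ⊎
    (length T ≢ 1 ×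
      (Σ (Polynomial n) λ g → IsDeg g r × Separates T g) ×
      (∀ (g : Polynomial n) (d : ℕ) → IsDeg g d → Separates T g → r ≤ d))

  sumFin : ∀ {m} → (Fin m → ℕ) → ℕ
  sumFin {m} d = sum (map d (allFin m))

{-# OPTIONS --safe #-}
module Submission where

-- Let G be a polynomial of degree r = a(T) vanishing on all of T but one point (G = 1 when
-- |T| = 1), so that Σ_{t ∈ T} G(t) ≠ 0.  By Fermat, χ(a) = Π_i (1 − P_i(a)^(q−1)) is the
-- indicator of the common zero set of the P_i, and χ·G has degree at most
-- (q−1)·Σ deg P_i + r < (q−1)·n.  Every monomial of that degree has an exponent below q − 1,
-- and Σ_{x ∈ F} x^j = 0 for j < q − 1, so Σ_{a ∈ Fⁿ} χ(a)·G(a) = 0.  If all common zeros lay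
-- in T, this sum would equal Σ_{t ∈ T} G(t) ≠ 0.

open import Level using (0ℓ)
open import Defs
open import Data.Nat as ℕ using (ℕ; zero; suc; _∸_; _<_; _≤_; z≤n; s≤s)
import Data.Nat.Properties as ℕₚ
open import Data.Fin using (Fin; zero; suc; punchIn)
open import Data.Fin.Properties using (any?; all?; ¬∀⟶∃¬; punchInᵢ≢i; punchIn-injective) renaming (_≟_ to _≟ᶠ_)
open import Data.Fin.Permutation using (Permutation; permutation)
open import Data.Vec as Vec using ([]; _∷_)
open import Data.Vec.Properties using (∷-injectiveˡ; ∷-injectiveʳ; ≡-dec)
open import Data.List as List using (List; []; _∷_; length; filter; tabulate; map; _++_)
open import Data.List.Properties using (length-filter; filter-complete; length-tabulate; map-tabulate)
open import Data.List.Relation.Unary.All as All using (All; []; _∷_)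
open import Data.List.Relation.Unary.All.Properties using (++⁺; all-filter) renaming (tabulate⁺ to All-tabulate⁺)
open import Data.List.Relation.Unary.Any using (here; there)
open import Data.List.Relation.Unary.AllPairs using ([]; _∷_)
open import Data.List.Relation.Unary.Unique.Propositional using (Unique)
open import Data.List.Relation.Unary.Unique.Propositional.Properties using () renaming (tabulate⁺ to Unique-tabulate⁺)
open import Data.List.Membership.Propositional using (_∈_; _∉_)
import Data.Nat.ListAction as ℕL
open import Data.Product using (Σ; ∃; _×_; _,_; proj₁; proj₂)
open import Data.Sum using (_⊎_; inj₁; inj₂; [_,_]′; map₁; fromInj₁; fromInj₂)
open import Data.Maybe using (nothing)
open import Function using (_∘_; id)
open import Relation.Nullary using (¬_; Dec; yes; no; ¬?; contradiction)
open import Relation.Nullary.Decidable using (_×-dec_; decidable-stable)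
open import Relation.Unary using (Decidable)
open import Relation.Binary.PropositionalEquality
  using (_≡_; _≢_; _≗_; refl; sym; trans; cong; cong₂; subst; subst₂; module ≡-Reasoning)
open import Algebra.Bundles using (CommutativeRing)
open import Tactic.RingSolver using (solve-∀)
open import Tactic.RingSolver.Core.AlmostCommutativeRing using (AlmostCommutativeRing; fromCommutativeRing)

module ChevalleyWarning {k : ℕ} (F : FiniteField (suc k)) where

  open FiniteField F using (isCommutativeRing; 0≢1; inverse)
  open Poly F using (Point; Exps; totalDeg; Polynomial; coeff; pow; evalMono; eval; IsAlgComplexity; sumFin)

  commutativeRing : CommutativeRing 0ℓ 0ℓ
  commutativeRing = record { isCommutativeRing = isCommutativeRing }

  ring : AlmostCommutativeRing 0ℓ 0ℓ
  ring = fromCommutativeRing commutativeRing (λ _ → nothing)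

  open AlmostCommutativeRing ring using (Carrier; _+_; _*_; -_; 0#; 1#)
  open CommutativeRing commutativeRing
    using ( +-identityˡ; +-identityʳ; +-assoc; -‿inverseˡ; -‿inverseʳ
          ; *-identityˡ; *-identityʳ; *-assoc; *-comm; zeroˡ; zeroʳ; distribʳ
          ; semiring; +-group; *-commutativeMonoid; *-commutativeSemigroup; +-commutativeSemigroup)
  open import Algebra.Properties.CommutativeSemigroup +-commutativeSemigroup using () renaming (x∙yz≈y∙xz to x+[y+z]≡y+[x+z])
  open import Algebra.Properties.CommutativeSemigroup *-commutativeSemigroup using () renaming (interchange to *-interchange)
  open import Algebra.Properties.CommutativeSemigroup ℕₚ.+-commutativeSemigroup using () renaming (interchange to +-interchange)
  open import Algebra.Properties.Ring (CommutativeRing.ring commutativeRing) using (-1*x≈-x)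
  open import Algebra.Properties.Group +-group using (identityʳ-unique; x∙y⁻¹≈ε⇒x≈y; ⁻¹-involutive; ε⁻¹≈ε)
  open import Algebra.Properties.Semiring.Sum semiring
    using (sum; sum-cong-≗; sum-remove; sum-replicate-zero; ∑-permute; ∑-distrib-+; *-distribˡ-sum; *-distribʳ-sum)
  open import Algebra.Properties.CommutativeMonoid.Sum *-commutativeMonoid
    using () renaming (sum to product; sum-cong-≗ to product-cong-≗; sum-remove to product-remove; ∑-permute to ∏-permute; ∑-distrib-+ to ∏-distrib-*)

  -- Field arithmetic

  0<k : 0 < k
  0<k = ℕₚ.n≢0⇒n>0 λ { refl → 0≢1 (Fin1-irrelevant 0# 1#) }
    where
    Fin1-irrelevant : (a b : Fin 1) → a ≡ b
    Fin1-irrelevant zero zero = refl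

  x*y≡0⇒x≡0⊎y≡0 : ∀ x y → x * y ≡ 0# → x ≡ 0# ⊎ y ≡ 0#
  x*y≡0⇒x≡0⊎y≡0 x y xy≡0 with x ≟ᶠ 0#
  ... | yes x≡0 = inj₁ x≡0
  ... | no x≢0 with inverse x x≢0
  ... | x⁻¹ , xx⁻¹≡1 = inj₂ (begin
    y               ≡⟨ sym (*-identityˡ y) ⟩
    1# * y          ≡⟨ cong (_* y) (trans (sym xx⁻¹≡1) (*-comm x x⁻¹)) ⟩
    (x⁻¹ * x) * y   ≡⟨ *-assoc x⁻¹ x y ⟩
    x⁻¹ * (x * y)   ≡⟨ cong (x⁻¹ *_) xy≡0 ⟩
    x⁻¹ * 0#        ≡⟨ zeroʳ x⁻¹ ⟩
    0#              ∎)
    where open ≡-Reasoning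

  x*y≢0 : ∀ {x y} → x ≢ 0# → y ≢ 0# → x * y ≢ 0#
  x*y≢0 {x} {y} x≢0 y≢0 = [ x≢0 , y≢0 ]′ ∘ x*y≡0⇒x≡0⊎y≡0 x y

  x*y≡y⇒x≡1⊎y≡0 : ∀ x y → x * y ≡ y → x ≡ 1# ⊎ y ≡ 0#
  x*y≡y⇒x≡1⊎y≡0 x y xy≡y = map₁ (x∙y⁻¹≈ε⇒x≈y x 1#) (x*y≡0⇒x≡0⊎y≡0 (x + - 1#) y (begin
    (x + - 1#) * y     ≡⟨ distribʳ y x (- 1#) ⟩
    x * y + - 1# * y   ≡⟨ cong (x * y +_) (-1*x≈-x y) ⟩
    x * y + - y        ≡⟨ cong (_+ - y) xy≡y ⟩
    y + - y            ≡⟨ -‿inverseʳ y ⟩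
    0#                 ∎))
    where open ≡-Reasoning

  x*y≡y⇒x≡1 : ∀ {x y} → y ≢ 0# → x * y ≡ y → x ≡ 1#
  x*y≡y⇒x≡1 {x} {y} y≢0 = fromInj₁ (λ y≡0 → contradiction y≡0 y≢0) ∘ x*y≡y⇒x≡1⊎y≡0 x y

  x*y≡y⇒y≡0 : ∀ {x y} → x ≢ 1# → x * y ≡ y → y ≡ 0#
  x*y≡y⇒y≡0 {x} {y} x≢1 = fromInj₂ (λ x≡1 → contradiction x≡1 x≢1) ∘ x*y≡y⇒x≡1⊎y≡0 x y

  pow-+ : ∀ x m n → pow x (m ℕ.+ n) ≡ pow x m * pow x n
  pow-+ x zero    n = sym (*-identityˡ _)
  pow-+ x (suc m) n = trans (cong (x *_) (pow-+ x m n)) (sym (*-assoc x _ _))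

  pow-distrib-* : ∀ x y n → pow (x * y) n ≡ pow x n * pow y n
  pow-distrib-* x y zero    = sym (*-identityˡ 1#)
  pow-distrib-* x y (suc n) = trans (cong ((x * y) *_) (pow-distrib-* x y n)) (*-interchange x y _ _)

  sum-zero : ∀ {n} (f : Fin n → Carrier) → (∀ i → f i ≡ 0#) → sum f ≡ 0#
  sum-zero {n} f f≡0 = trans (sum-cong-≗ f≡0) (sum-replicate-zero n)

  sum-select : ∀ {n} (t : Fin (suc n)) (f : Fin (suc n) → Carrier) →
               (∀ x → x ≢ t → f x ≡ 0#) → sum f ≡ f t
  sum-select t f f≡0 = begin
    sum f                            ≡⟨ sum-remove {i = t} f ⟩
    f t + sum (f ∘ punchIn t)        ≡⟨ cong (f t +_) (sum-zero _ (λ i → f≡0 _ (punchInᵢ≢i t i))) ⟩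
    f t + 0#                         ≡⟨ +-identityʳ (f t) ⟩
    f t                              ∎
    where open ≡-Reasoning

  product-zero : ∀ {n} (f : Fin (suc n) → Carrier) i → f i ≡ 0# → product f ≡ 0#
  product-zero f i fi≡0 =
    trans (product-remove {i = i} f) (trans (cong (_* product (f ∘ punchIn i)) fi≡0) (zeroˡ _))

  product-one : ∀ {n} (f : Fin n → Carrier) → (∀ i → f i ≡ 1#) → product f ≡ 1#
  product-one {zero}  f f≡1 = refl
  product-one {suc n} f f≡1 =
    trans (cong₂ _*_ (f≡1 zero) (product-one (f ∘ suc) (f≡1 ∘ suc))) (*-identityˡ 1#)

  product-nonzero : ∀ {n} (f : Fin n → Carrier) → (∀ i → f i ≢ 0#) → product f ≢ 0#
  product-nonzero {zero}  f f≢0 1≡0 = 0≢1 (sym 1≡0)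
  product-nonzero {suc n} f f≢0     = x*y≢0 (f≢0 zero) (product-nonzero (f ∘ suc) (f≢0 ∘ suc))

  product-const : ∀ n c → product {n} (λ _ → c) ≡ pow c n
  product-const zero    c = refl
  product-const (suc n) c = cong (c *_) (product-const n c)

  -- Power sums and Fermat's little theorem

  nonzero : Fin k → Carrier
  nonzero = punchIn 0#

  scaling : ∀ c → c ≢ 0# → Permutation (suc k) (suc k)
  scaling c c≢0 = permutation (c *_) (c⁻¹ *_) (cancel c c⁻¹ cc⁻¹≡1) (cancel c⁻¹ c (trans (*-comm c⁻¹ c) cc⁻¹≡1))
    where
    c⁻¹ : Carrier
    c⁻¹ = proj₁ (inverse c c≢0)
    cc⁻¹≡1 : c * c⁻¹ ≡ 1#
    cc⁻¹≡1 = proj₂ (inverse c c≢0)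
    cancel : ∀ a b → a * b ≡ 1# → ∀ y → a * (b * y) ≡ y
    cancel a b ab≡1 y = trans (sym (*-assoc a b y)) (trans (cong (_* y) ab≡1) (*-identityˡ y))

  translation : Permutation (suc k) (suc k)
  translation = permutation (_+ 1#) (_+ - 1#) (cancel (- 1#) 1# (-‿inverseˡ 1#)) (cancel 1# (- 1#) (-‿inverseʳ 1#))
    where
    cancel : ∀ a b → a + b ≡ 0# → ∀ y → (y + a) + b ≡ y
    cancel a b a+b≡0 y = trans (+-assoc y a b) (trans (cong (y +_) a+b≡0) (+-identityʳ y))

  powerSum : ℕ → Carrier
  powerSum j = sum (λ x → pow x j)

  powerSum-0 : powerSum 0 ≡ 0#
  powerSum-0 = identityʳ-unique (sum id) (powerSum 0) (sym (begin
    sum id                     ≡⟨ ∑-permute id translation ⟩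
    sum (_+ 1#)                ≡⟨ ∑-distrib-+ id (λ _ → 1#) ⟩
    sum id + powerSum 0        ∎))
    where open ≡-Reasoning

  powerSum-scale : ∀ j c → c ≢ 0# → pow c j * powerSum j ≡ powerSum j
  powerSum-scale j c c≢0 = begin
    pow c j * powerSum j                ≡⟨ *-distribˡ-sum (pow c j) (λ x → pow x j) ⟩
    sum (λ x → pow c j * pow x j)       ≡⟨ sum-cong-≗ (λ x → sym (pow-distrib-* c x j)) ⟩
    sum (λ x → pow (c * x) j)           ≡⟨ sym (∑-permute (λ x → pow x j) (scaling c c≢0)) ⟩
    powerSum j                          ∎
    where open ≡-Reasoning

  unlessZero : Carrier → Carrier → Carrier
  unlessZero x y with x ≟ᶠ 0#
  ... | yes _ = 1#
  ... | no  _ = y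

  unlessZero-0 : ∀ {x} y → x ≡ 0# → unlessZero x y ≡ 1#
  unlessZero-0 {x} y x≡0 with x ≟ᶠ 0#
  ... | yes _   = refl
  ... | no  x≢0 = contradiction x≡0 x≢0

  unlessZero-≢0 : ∀ {x} y → x ≢ 0# → unlessZero x y ≡ y
  unlessZero-≢0 {x} y x≢0 with x ≟ᶠ 0#
  ... | yes x≡0 = contradiction x≡0 x≢0
  ... | no  _   = refl

  fermat : ∀ c → c ≢ 0# → pow c k ≡ 1#
  fermat c c≢0 = x*y≡y⇒x≡1 (product-nonzero f f≢0) (begin
    pow c k * product f               ≡⟨ cong (_* product f) (sym ∏g≡cᵏ) ⟩
    product g * product f             ≡⟨ sym (∏-distrib-* g f) ⟩
    product (λ x → g x * f x)         ≡⟨ product-cong-≗ (λ x → sym (f[cx]≡g[x]f[x] x)) ⟩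
    product (λ x → f (c * x))         ≡⟨ sym (∏-permute f (scaling c c≢0)) ⟩
    product f                         ∎)
    where
    open ≡-Reasoning
    -- replacing 0 by 1 makes x ↦ c * x multiply f by c at exactly the k nonzero points
    f g : Carrier → Carrier
    f x = unlessZero x x
    g x = unlessZero x c

    f≢0 : ∀ x → f x ≢ 0#
    f≢0 x with x ≟ᶠ 0#
    ... | yes _   = λ 1≡0 → 0≢1 (sym 1≡0)
    ... | no  x≢0 = x≢0

    f[cx]≡g[x]f[x] : ∀ x → f (c * x) ≡ g x * f x
    f[cx]≡g[x]f[x] x = cases (x ≟ᶠ 0#)
      where
      cases : Dec (x ≡ 0#) → f (c * x) ≡ g x * f x
      cases (yes x≡0) = begin
        f (c * x)   ≡⟨ unlessZero-0 (c * x) (trans (cong (c *_) x≡0) (zeroʳ c)) ⟩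
        1#          ≡⟨ sym (*-identityˡ 1#) ⟩
        1# * 1#     ≡⟨ sym (cong₂ _*_ (unlessZero-0 c x≡0) (unlessZero-0 x x≡0)) ⟩
        g x * f x   ∎
      cases (no x≢0) = begin
        f (c * x)   ≡⟨ unlessZero-≢0 (c * x) (x*y≢0 c≢0 x≢0) ⟩
        c * x       ≡⟨ sym (cong₂ _*_ (unlessZero-≢0 c x≢0) (unlessZero-≢0 x x≢0)) ⟩
        g x * f x   ∎

    ∏g≡cᵏ : product g ≡ pow c k
    ∏g≡cᵏ = begin
      product g                         ≡⟨ product-remove {i = 0#} g ⟩
      g 0# * product (g ∘ nonzero)      ≡⟨ cong₂ _*_ (unlessZero-0 c refl) (product-cong-≗ (λ i → unlessZero-≢0 c (punchInᵢ≢i 0# i))) ⟩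
      1# * product {k} (λ _ → c)        ≡⟨ *-identityˡ _ ⟩
      product {k} (λ _ → c)             ≡⟨ product-const k c ⟩
      pow c k                           ∎

  -- Roots of univariate polynomials

  horner : List Carrier → Carrier → Carrier
  horner []      x = 0#
  horner (a ∷ p) x = a + x * horner p x

  horner-divide : ∀ a p r → ∃ λ quotient → length quotient ≡ length p ×
                  (∀ x → horner (a ∷ p) x ≡ (x + - r) * horner quotient x + horner (a ∷ p) r)
  horner-divide a [] r = [] , refl , λ x → begin
    a + x * 0#                       ≡⟨ cong (a +_) (trans (zeroʳ x) (sym (zeroʳ r))) ⟩
    a + r * 0#                       ≡⟨ sym (+-identityˡ _) ⟩
    0# + (a + r * 0#)                ≡⟨ cong (_+ (a + r * 0#)) (sym (zeroʳ (x + - r))) ⟩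
    (x + - r) * 0# + (a + r * 0#)    ∎
    where open ≡-Reasoning
  horner-divide a (b ∷ p) r with horner-divide b p r
  ... | quotient , length-quotient , divides =
    horner (b ∷ p) r ∷ quotient , cong suc length-quotient , λ x → begin
      a + x * horner (b ∷ p) x                              ≡⟨ cong (λ y → a + x * y) (divides x) ⟩
      a + x * ((x + - r) * Q x + B)                         ≡⟨ sym (trans (cong (A x +_) (zeroˡ B)) (+-identityʳ (A x))) ⟩
      a + x * ((x + - r) * Q x + B) + 0# * B                ≡⟨ cong (λ y → A x + y * B) (sym (-‿inverseˡ r)) ⟩
      a + x * ((x + - r) * Q x + B) + (- r + r) * B         ≡⟨ regroup x (- r) r B (Q x) a ⟩
      (x + - r) * (B + x * Q x) + (a + r * B)               ∎
    where
    open ≡-Reasoning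
    B : Carrier
    B = horner (b ∷ p) r
    Q A : Carrier → Carrier
    Q = horner quotient
    A x = a + x * ((x + - r) * Q x + B)
    regroup : ∀ x s r B Q a → a + x * ((x + s) * Q + B) + (s + r) * B ≡ (x + s) * (B + x * Q) + (a + r * B)
    regroup = solve-∀ ring

  roots⇒horner≡0 : ∀ {rs} → Unique rs → ∀ p → length p ≤ length rs →
                   All (λ r → horner p r ≡ 0#) rs → ∀ x → horner p x ≡ 0#
  roots⇒horner≡0 _ [] _ _ x = refl
  roots⇒horner≡0 {r ∷ rs} (r≢rs ∷ unique) (a ∷ p) (s≤s length≤) (root ∷ roots) x
    with horner-divide a p r
  ... | quotient , length-quotient , divides = begin
    horner (a ∷ p) x                                       ≡⟨ divides x ⟩
    (x + - r) * horner quotient x + horner (a ∷ p) r       ≡⟨ cong₂ (λ y z → (x + - r) * y + z) quotient≡0 root ⟩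
    (x + - r) * 0# + 0#                                    ≡⟨ trans (+-identityʳ _) (zeroʳ _) ⟩
    0#                                                     ∎
    where
    open ≡-Reasoning
    quotient-root : ∀ {s} → r ≢ s → horner (a ∷ p) s ≡ 0# → horner quotient s ≡ 0#
    quotient-root {s} r≢s root-s =
      fromInj₂ (λ s-r≡0 → contradiction (sym (x∙y⁻¹≈ε⇒x≈y s r s-r≡0)) r≢s)
        (x*y≡0⇒x≡0⊎y≡0 (s + - r) (horner quotient s) (begin
          (s + - r) * horner quotient s                      ≡⟨ sym (+-identityʳ _) ⟩
          (s + - r) * horner quotient s + 0#                 ≡⟨ cong ((s + - r) * horner quotient s +_) (sym root) ⟩
          (s + - r) * horner quotient s + horner (a ∷ p) r   ≡⟨ sym (divides s) ⟩
          horner (a ∷ p) s                                   ≡⟨ root-s ⟩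
          0#                                                 ∎))
    quotient≡0 : horner quotient x ≡ 0#
    quotient≡0 = roots⇒horner≡0 unique quotient (subst (_≤ length rs) (sym length-quotient) length≤)
                   (All.zipWith (λ (r≢s , root-s) → quotient-root r≢s root-s) (r≢rs , roots)) x

  xⁿ : ℕ → List Carrier
  xⁿ zero    = 1# ∷ []
  xⁿ (suc n) = 0# ∷ xⁿ n

  length-xⁿ : ∀ n → length (xⁿ n) ≡ suc n
  length-xⁿ zero    = refl
  length-xⁿ (suc n) = cong suc (length-xⁿ n)

  horner-xⁿ : ∀ n x → horner (xⁿ n) x ≡ pow x n
  horner-xⁿ zero    x = trans (cong (1# +_) (zeroʳ x)) (+-identityʳ 1#)
  horner-xⁿ (suc n) x = trans (+-identityˡ _) (cong (x *_) (horner-xⁿ n x))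

  nonzeros : List Carrier
  nonzeros = tabulate nonzero

  -- otherwise the k nonzero elements would be too many roots of x^(j+1) − 1
  unity-roots-bound : ∀ j → (∀ c → c ≢ 0# → pow c (suc j) ≡ 1#) → k ≤ suc j
  unity-roots-bound j unity = ℕₚ.≮⇒≥ λ suc-j<k → 0≢1 (sym (1≡0 suc-j<k))
    where
    p : List Carrier
    p = - 1# ∷ xⁿ j
    horner-p : ∀ x → horner p x ≡ - 1# + pow x (suc j)
    horner-p x = cong (λ y → - 1# + x * y) (horner-xⁿ j x)
    1≡0 : suc j < k → 1# ≡ 0#
    1≡0 suc-j<k = begin
      1#                               ≡⟨ sym (⁻¹-involutive 1#) ⟩
      - - 1#                           ≡⟨ cong -_ -1≡0 ⟩
      - 0#                             ≡⟨ ε⁻¹≈ε ⟩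
      0#                               ∎
      where
      open ≡-Reasoning
      roots : All (λ r → horner p r ≡ 0#) nonzeros
      roots = All-tabulate⁺ λ i → begin
        horner p (nonzero i)           ≡⟨ horner-p (nonzero i) ⟩
        - 1# + pow (nonzero i) (suc j) ≡⟨ cong (- 1# +_) (unity (nonzero i) (punchInᵢ≢i 0# i)) ⟩
        - 1# + 1#                      ≡⟨ -‿inverseˡ 1# ⟩
        0#                             ∎
      length-p≤ : length p ≤ length nonzeros
      length-p≤ = subst₂ _≤_ (cong suc (sym (length-xⁿ j))) (sym (length-tabulate nonzero)) suc-j<k
      -1≡0 : - 1# ≡ 0#
      -1≡0 = begin
        - 1#                           ≡⟨ sym (+-identityʳ (- 1#)) ⟩
        - 1# + 0#                      ≡⟨ cong (- 1# +_) (sym (zeroˡ (horner (xⁿ j) 0#))) ⟩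
        horner p 0#                    ≡⟨ roots⇒horner≡0 (Unique-tabulate⁺ (punchIn-injective 0# _ _)) p length-p≤ roots 0# ⟩
        0#                             ∎

  powerSum-vanishes : ∀ j → j < k → powerSum j ≡ 0#
  powerSum-vanishes zero    _   = powerSum-0
  powerSum-vanishes (suc j) j<k with any? (λ c → ¬? (c ≟ᶠ 0#) ×-dec ¬? (pow c (suc j) ≟ᶠ 1#))
  ... | yes (c , c≢0 , cʲ≢1) = x*y≡y⇒y≡0 cʲ≢1 (powerSum-scale (suc j) c c≢0)
  ... | no ∄c = contradiction j<k (ℕₚ.≤⇒≯ (unity-roots-bound j unity))
    where
    unity : ∀ c → c ≢ 0# → pow c (suc j) ≡ 1#
    unity c c≢0 = decidable-stable (pow c (suc j) ≟ᶠ 1#) (λ cʲ≢1 → ∄c (c , c≢0 , cʲ≢1))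

  -- Sums over Fⁿ

  sumPoints : ∀ n → (Point n → Carrier) → Carrier
  sumPoints zero    f = f []
  sumPoints (suc n) f = sum (λ x → sumPoints n (f ∘ (x ∷_)))

  sumPoints-cong : ∀ n {f g : Point n → Carrier} → f ≗ g → sumPoints n f ≡ sumPoints n g
  sumPoints-cong zero    f≗g = f≗g []
  sumPoints-cong (suc n) f≗g = sum-cong-≗ (λ x → sumPoints-cong n (f≗g ∘ (x ∷_)))

  sumPoints-zero : ∀ n (f : Point n → Carrier) → (∀ a → f a ≡ 0#) → sumPoints n f ≡ 0#
  sumPoints-zero zero    f f≡0 = f≡0 []
  sumPoints-zero (suc n) f f≡0 = sum-zero _ (λ x → sumPoints-zero n (f ∘ (x ∷_)) (f≡0 ∘ (x ∷_)))

  sumPoints-+ : ∀ n (f g : Point n → Carrier) → sumPoints n (λ a → f a + g a) ≡ sumPoints n f + sumPoints n g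
  sumPoints-+ zero    f g = refl
  sumPoints-+ (suc n) f g = trans (sum-cong-≗ (λ x → sumPoints-+ n (f ∘ (x ∷_)) (g ∘ (x ∷_))))
                                  (∑-distrib-+ (λ x → sumPoints n (f ∘ (x ∷_))) (λ x → sumPoints n (g ∘ (x ∷_))))

  sumPoints-*ˡ : ∀ n c (f : Point n → Carrier) → sumPoints n (λ a → c * f a) ≡ c * sumPoints n f
  sumPoints-*ˡ zero    c f = refl
  sumPoints-*ˡ (suc n) c f = trans (sum-cong-≗ (λ x → sumPoints-*ˡ n c (f ∘ (x ∷_))))
                                   (sym (*-distribˡ-sum c (λ x → sumPoints n (f ∘ (x ∷_)))))

  sumPoints-select : ∀ n (t : Point n) (f : Point n → Carrier) → (∀ a → a ≢ t → f a ≡ 0#) → sumPoints n f ≡ f t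
  sumPoints-select zero    []       f f≡0 = refl
  sumPoints-select (suc n) (x ∷ ts) f f≡0 =
    trans (sum-select x _ (λ y y≢x → sumPoints-zero n _ (λ as → f≡0 (y ∷ as) (y≢x ∘ ∷-injectiveˡ))))
          (sumPoints-select n ts (f ∘ (x ∷_)) (λ as as≢ts → f≡0 (x ∷ as) (as≢ts ∘ ∷-injectiveʳ)))

  -- The sum factorises over the coordinates, and the degree bound forces an exponent below k.
  sumPoints-evalMono : ∀ n (e : Exps n) → totalDeg e < k ℕ.* n → sumPoints n (evalMono e) ≡ 0#
  sumPoints-evalMono zero    []       deg<0 = contradiction (subst (0 <_) (ℕₚ.*-zeroʳ k) deg<0) (λ ())
  sumPoints-evalMono (suc n) (e ∷ es) deg<  = begin
    sum (λ x → sumPoints n (λ as → pow x e * evalMono es as))   ≡⟨ sum-cong-≗ (λ x → sumPoints-*ˡ n (pow x e) (evalMono es)) ⟩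
    sum (λ x → pow x e * sumPoints n (evalMono es))             ≡⟨ sym (*-distribʳ-sum (sumPoints n (evalMono es)) (λ x → pow x e)) ⟩
    powerSum e * sumPoints n (evalMono es)                      ≡⟨ factor≡0 (e ℕₚ.<? k) ⟩
    0#                                                          ∎
    where
    open ≡-Reasoning
    factor≡0 : Dec (e < k) → powerSum e * sumPoints n (evalMono es) ≡ 0#
    factor≡0 (yes e<k) = trans (cong (_* sumPoints n (evalMono es)) (powerSum-vanishes e e<k)) (zeroˡ _)
    factor≡0 (no  e≮k) = trans (cong (powerSum e *_) (sumPoints-evalMono n es es<)) (zeroʳ _)
      where
      es< : totalDeg es < k ℕ.* n
      es< = ℕₚ.+-cancelˡ-< k (totalDeg es) (k ℕ.* n)
              (ℕₚ.≤-<-trans (ℕₚ.+-monoˡ-≤ (totalDeg es) (ℕₚ.≮⇒≥ e≮k))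
                            (subst (e ℕ.+ totalDeg es <_) (ℕₚ.*-suc k n) deg<))

  -- Polynomial functions of bounded degree

  AllTerms≤ : ∀ {n} → ℕ → Polynomial n → Set
  AllTerms≤ D = All (λ term → totalDeg (proj₂ term) ≤ D)

  DegreeAtMost : ∀ {n} → ℕ → (Point n → Carrier) → Set
  DegreeAtMost {n} D f = Σ (Polynomial n) λ P → AllTerms≤ D P × f ≗ eval P

  sumPoints-eval : ∀ {n D} (P : Polynomial n) → AllTerms≤ D P → D < k ℕ.* n → sumPoints n (eval P) ≡ 0#
  sumPoints-eval {n} []            _              _   = sumPoints-zero n _ (λ _ → refl)
  sumPoints-eval {n} ((c , e) ∷ P) (e≤D ∷ P≤D) D< = begin
    sumPoints n (λ a → c * evalMono e a + eval P a)            ≡⟨ sumPoints-+ n _ _ ⟩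
    sumPoints n (λ a → c * evalMono e a) + sumPoints n (eval P) ≡⟨ cong₂ _+_ (sumPoints-*ˡ n c _) (sumPoints-eval P P≤D D<) ⟩
    c * sumPoints n (evalMono e) + 0#                          ≡⟨ cong (λ y → c * y + 0#) (sumPoints-evalMono n e (ℕₚ.≤-<-trans e≤D D<)) ⟩
    c * 0# + 0#                                                ≡⟨ trans (+-identityʳ _) (zeroʳ c) ⟩
    0#                                                         ∎
    where open ≡-Reasoning

  sumPoints-degreeAtMost : ∀ {n D} {f : Point n → Carrier} → DegreeAtMost D f → D < k ℕ.* n → sumPoints n f ≡ 0#
  sumPoints-degreeAtMost {n} (P , P≤D , f≗P) D< = trans (sumPoints-cong n f≗P) (sumPoints-eval P P≤D D<)

  degreeAtMost-weaken : ∀ {n D E} {f : Point n → Carrier} → D ≤ E → DegreeAtMost D f → DegreeAtMost E f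
  degreeAtMost-weaken D≤E (P , P≤D , f≗P) = P , All.map (λ e≤D → ℕₚ.≤-trans e≤D D≤E) P≤D , f≗P

  degreeAtMost-const : ∀ {n} c → DegreeAtMost {n} 0 (λ _ → c)
  degreeAtMost-const {n} c = (c , Vec.replicate n 0) ∷ [] , ℕₚ.≤-reflexive (totalDeg-0s n) ∷ [] , λ a → begin
    c                                 ≡⟨ sym (*-identityʳ c) ⟩
    c * 1#                            ≡⟨ cong (c *_) (sym (evalMono-0s a)) ⟩
    c * evalMono (Vec.replicate n 0) a ≡⟨ sym (+-identityʳ _) ⟩
    c * evalMono (Vec.replicate n 0) a + 0# ∎
    where
    open ≡-Reasoning
    totalDeg-0s : ∀ n → totalDeg (Vec.replicate n 0) ≡ 0
    totalDeg-0s zero    = refl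
    totalDeg-0s (suc n) = totalDeg-0s n
    evalMono-0s : ∀ {n} (a : Point n) → evalMono (Vec.replicate n 0) a ≡ 1#
    evalMono-0s []      = refl
    evalMono-0s (x ∷ a) = trans (*-identityˡ _) (evalMono-0s a)

  eval-++ : ∀ {n} (P P′ : Polynomial n) a → eval (P ++ P′) a ≡ eval P a + eval P′ a
  eval-++ []            P′ a = sym (+-identityˡ _)
  eval-++ ((c , e) ∷ P) P′ a = trans (cong (c * evalMono e a +_) (eval-++ P P′ a)) (sym (+-assoc _ _ _))

  degreeAtMost-+ : ∀ {n D} {f g : Point n → Carrier} → DegreeAtMost D f → DegreeAtMost D g → DegreeAtMost D (λ a → f a + g a)
  degreeAtMost-+ (P , P≤D , f≗P) (P′ , P′≤D , g≗P′) =
    P ++ P′ , ++⁺ P≤D P′≤D , λ a → trans (cong₂ _+_ (f≗P a) (g≗P′ a)) (sym (eval-++ P P′ a))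

  totalDeg-zipWith-+ : ∀ {n} (e e′ : Exps n) → totalDeg (Vec.zipWith ℕ._+_ e e′) ≡ totalDeg e ℕ.+ totalDeg e′
  totalDeg-zipWith-+ []       []         = refl
  totalDeg-zipWith-+ (d ∷ es) (d′ ∷ es′) =
    trans (cong ((d ℕ.+ d′) ℕ.+_) (totalDeg-zipWith-+ es es′)) (+-interchange d d′ (totalDeg es) (totalDeg es′))

  evalMono-zipWith-+ : ∀ {n} (e e′ : Exps n) a → evalMono (Vec.zipWith ℕ._+_ e e′) a ≡ evalMono e a * evalMono e′ a
  evalMono-zipWith-+ []       []         []      = sym (*-identityˡ 1#)
  evalMono-zipWith-+ (d ∷ es) (d′ ∷ es′) (x ∷ a) =
    trans (cong₂ _*_ (pow-+ x d d′) (evalMono-zipWith-+ es es′ a)) (*-interchange _ _ _ _)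

  _⊙_ : ∀ {n} → Carrier × Exps n → Carrier × Exps n → Carrier × Exps n
  (c , e) ⊙ (c′ , e′) = c * c′ , Vec.zipWith ℕ._+_ e e′

  _⊗_ : ∀ {n} → Polynomial n → Polynomial n → Polynomial n
  []      ⊗ P′ = []
  (t ∷ P) ⊗ P′ = map (t ⊙_) P′ ++ (P ⊗ P′)

  eval-map-⊙ : ∀ {n} c (e : Exps n) P a → eval (map ((c , e) ⊙_) P) a ≡ (c * evalMono e a) * eval P a
  eval-map-⊙ c e []              a = sym (zeroʳ _)
  eval-map-⊙ c e ((c′ , e′) ∷ P) a =
    trans (cong₂ _+_ (cong ((c * c′) *_) (evalMono-zipWith-+ e e′ a)) (eval-map-⊙ c e P a))
          (regroup c c′ (evalMono e a) (evalMono e′ a) (eval P a))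
    where
    regroup : ∀ c c′ m m′ r → (c * c′) * (m * m′) + (c * m) * r ≡ (c * m) * (c′ * m′ + r)
    regroup = solve-∀ ring

  eval-⊗ : ∀ {n} (P P′ : Polynomial n) a → eval (P ⊗ P′) a ≡ eval P a * eval P′ a
  eval-⊗ []            P′ a = sym (zeroˡ _)
  eval-⊗ ((c , e) ∷ P) P′ a = begin
    eval (map ((c , e) ⊙_) P′ ++ (P ⊗ P′)) a                ≡⟨ eval-++ (map ((c , e) ⊙_) P′) (P ⊗ P′) a ⟩
    eval (map ((c , e) ⊙_) P′) a + eval (P ⊗ P′) a          ≡⟨ cong₂ _+_ (eval-map-⊙ c e P′ a) (eval-⊗ P P′ a) ⟩
    (c * evalMono e a) * eval P′ a + eval P a * eval P′ a   ≡⟨ sym (distribʳ _ _ _) ⟩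
    (c * evalMono e a + eval P a) * eval P′ a              ∎
    where open ≡-Reasoning

  AllTerms≤-map-⊙ : ∀ {n D E} c (e : Exps n) → totalDeg e ≤ D → ∀ P → AllTerms≤ E P → AllTerms≤ (D ℕ.+ E) (map ((c , e) ⊙_) P)
  AllTerms≤-map-⊙ c e e≤D []              []            = []
  AllTerms≤-map-⊙ {D = D} {E} c e e≤D ((c′ , e′) ∷ P) (e′≤E ∷ P≤E) =
    subst (_≤ D ℕ.+ E) (sym (totalDeg-zipWith-+ e e′)) (ℕₚ.+-mono-≤ e≤D e′≤E) ∷ AllTerms≤-map-⊙ c e e≤D P P≤E

  AllTerms≤-⊗ : ∀ {n D E} (P P′ : Polynomial n) → AllTerms≤ D P → AllTerms≤ E P′ → AllTerms≤ (D ℕ.+ E) (P ⊗ P′)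
  AllTerms≤-⊗ []            P′ []          P′≤E = []
  AllTerms≤-⊗ ((c , e) ∷ P) P′ (e≤D ∷ P≤D) P′≤E = ++⁺ (AllTerms≤-map-⊙ c e e≤D P′ P′≤E) (AllTerms≤-⊗ P P′ P≤D P′≤E)

  degreeAtMost-* : ∀ {n D E} {f g : Point n → Carrier} → DegreeAtMost D f → DegreeAtMost E g → DegreeAtMost (D ℕ.+ E) (λ a → f a * g a)
  degreeAtMost-* (P , P≤D , f≗P) (P′ , P′≤E , g≗P′) =
    P ⊗ P′ , AllTerms≤-⊗ P P′ P≤D P′≤E , λ a → trans (cong₂ _*_ (f≗P a) (g≗P′ a)) (sym (eval-⊗ P P′ a))

  degreeAtMost-pow : ∀ {n D} {f : Point n → Carrier} → DegreeAtMost D f → ∀ j → DegreeAtMost (j ℕ.* D) (λ a → pow (f a) j)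
  degreeAtMost-pow f≤D zero    = degreeAtMost-const 1#
  degreeAtMost-pow f≤D (suc j) = degreeAtMost-* f≤D (degreeAtMost-pow f≤D j)

  _≟ᴱ_ : ∀ {n} (e e′ : Exps n) → Dec (e ≡ e′)
  _≟ᴱ_ = ≡-dec ℕ._≟_

  coeff-here : ∀ {n} c (e : Exps n) P → coeff ((c , e) ∷ P) e ≡ c + coeff P e
  coeff-here c e P with e ≟ᴱ e
  ... | yes _   = refl
  ... | no  e≢e = contradiction refl e≢e

  coeff-there : ∀ {n} c {e e′ : Exps n} P → e ≢ e′ → coeff ((c , e) ∷ P) e′ ≡ coeff P e′
  coeff-there c {e} {e′} P e≢e′ with e ≟ᴱ e′
  ... | yes e≡e′ = contradiction e≡e′ e≢e′
  ... | no  _    = refl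

  coeff-∷-cong : ∀ {n} term {P P′ : Polynomial n} {e} → coeff P e ≡ coeff P′ e → coeff (term ∷ P) e ≡ coeff (term ∷ P′) e
  coeff-∷-cong (c , e′) {e = e} P≡P′ with e′ ≟ᴱ e
  ... | yes _ = cong (c +_) P≡P′
  ... | no  _ = P≡P′

  module _ {n} {p} {E : Exps n → Set p} (E? : Decidable E) where

    eval-partition : ∀ P a → eval P a ≡ eval (filter (E? ∘ proj₂) P) a + eval (filter (¬? ∘ E? ∘ proj₂) P) a
    eval-partition []            a = sym (+-identityˡ 0#)
    eval-partition ((c , e) ∷ P) a with E? e
    ... | yes _ = trans (cong (c * evalMono e a +_) (eval-partition P a)) (sym (+-assoc _ _ _))
    ... | no  _ = trans (cong (c * evalMono e a +_) (eval-partition P a)) (x+[y+z]≡y+[x+z] _ _ _)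

    coeff-filter-accept : ∀ P {e} → E e → coeff (filter (E? ∘ proj₂) P) e ≡ coeff P e
    coeff-filter-accept []             Ee = refl
    coeff-filter-accept ((c , e′) ∷ P) {e} Ee with E? e′
    ... | yes _   = coeff-∷-cong (c , e′) (coeff-filter-accept P Ee)
    ... | no ¬Ee′ = trans (coeff-filter-accept P Ee) (sym (coeff-there c {e′} {e} P λ { refl → ¬Ee′ Ee }))

    coeff-filter-reject : ∀ P {e} → ¬ E e → coeff (filter (E? ∘ proj₂) P) e ≡ 0#
    coeff-filter-reject []             ¬Ee = refl
    coeff-filter-reject ((c , e′) ∷ P) {e} ¬Ee with E? e′
    ... | yes Ee′ = trans (coeff-there c {e′} {e} (filter (E? ∘ proj₂) P) λ { refl → ¬Ee Ee′ }) (coeff-filter-reject P ¬Ee)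
    ... | no  _   = coeff-filter-reject P ¬Ee

  eval-filter-≡ : ∀ {n} (e : Exps n) P a → eval (filter ((_≟ᴱ e) ∘ proj₂) P) a ≡ coeff P e * evalMono e a
  eval-filter-≡ e []             a = sym (zeroˡ _)
  eval-filter-≡ e ((c , e′) ∷ P) a with e′ ≟ᴱ e
  ... | yes refl = trans (cong (c * evalMono e a +_) (eval-filter-≡ e P a)) (sym (distribʳ _ c _))
  ... | no  _    = eval-filter-≡ e P a

  coeff≡0⇒eval≡0 : ∀ {n} (P : Polynomial n) → (∀ e → coeff P e ≡ 0#) → ∀ a → eval P a ≡ 0#
  coeff≡0⇒eval≡0 P = bounded (length P) P ℕₚ.≤-refl
    where
    -- dropping all terms with the exponent of the head term strictly shortens P
    bounded : ∀ {n} fuel (P : Polynomial n) → length P ≤ fuel → (∀ e → coeff P e ≡ 0#) → ∀ a → eval P a ≡ 0#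
    bounded _          []            _             _       _ = refl
    bounded (suc fuel) ((c , e) ∷ P) (s≤s length≤) coeff≡0 a = begin
      c * m + eval P a                                            ≡⟨ cong (c * m +_) (eval-partition (_≟ᴱ e) P a) ⟩
      c * m + (eval (filter ((_≟ᴱ e) ∘ proj₂) P) a + eval rest a)  ≡⟨ cong (λ y → c * m + (y + eval rest a)) (eval-filter-≡ e P a) ⟩
      c * m + (coeff P e * m + eval rest a)                       ≡⟨ regroup c (coeff P e) m (eval rest a) ⟩
      (c + coeff P e) * m + eval rest a                           ≡⟨ cong (λ y → y * m + eval rest a) (trans (sym (coeff-here c e P)) (coeff≡0 e)) ⟩
      0# * m + eval rest a                                        ≡⟨ trans (cong (_+ eval rest a) (zeroˡ m)) (+-identityˡ _) ⟩
      eval rest a                                                 ≡⟨ bounded fuel rest (ℕₚ.≤-trans (length-filter _ P) length≤) rest-coeff≡0 a ⟩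
      0#                                                          ∎
      where
      open ≡-Reasoning
      m : Carrier
      m = evalMono e a
      rest : Polynomial _
      rest = filter (¬? ∘ (_≟ᴱ e) ∘ proj₂) P
      regroup : ∀ x y z w → x * z + (y * z + w) ≡ (x + y) * z + w
      regroup = solve-∀ ring
      rest-coeff≡0 : ∀ e′ → coeff rest e′ ≡ 0#
      rest-coeff≡0 e′ with e′ ≟ᴱ e
      ... | yes refl = coeff-filter-reject (λ e″ → ¬? (e″ ≟ᴱ e)) P (λ e≢e → e≢e refl)
      ... | no  e′≢e = trans (coeff-filter-accept (λ e″ → ¬? (e″ ≟ᴱ e)) P e′≢e)
                             (trans (sym (coeff-there c P (e′≢e ∘ sym))) (coeff≡0 e′))

  coeff-vanishing-above⇒degreeAtMost : ∀ {n} (P : Polynomial n) d → (∀ e → d < totalDeg e → coeff P e ≡ 0#) →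
                                       DegreeAtMost d (eval P)
  coeff-vanishing-above⇒degreeAtMost P d coeff≡0 = low , all-filter (low? ∘ proj₂) P , λ a → begin
    eval P a                  ≡⟨ eval-partition low? P a ⟩
    eval low a + eval high a  ≡⟨ cong (eval low a +_) (coeff≡0⇒eval≡0 high high-coeff≡0 a) ⟩
    eval low a + 0#           ≡⟨ +-identityʳ _ ⟩
    eval low a                ∎
    where
    open ≡-Reasoning
    low? : Decidable (λ e → totalDeg e ≤ d)
    low? e = totalDeg e ℕₚ.≤? d
    low high : Polynomial _
    low = filter (low? ∘ proj₂) P
    high = filter (¬? ∘ low? ∘ proj₂) P
    high-coeff≡0 : ∀ e → coeff high e ≡ 0#
    high-coeff≡0 e with low? e
    ... | yes e≤d = coeff-filter-reject (¬? ∘ low?) P (λ e≰d → e≰d e≤d)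
    ... | no  e≰d = trans (coeff-filter-accept (¬? ∘ low?) P e≰d) (coeff≡0 e (ℕₚ.≰⇒> e≰d))

  -- The indicator function of the common zero set

  sumFin-suc : ∀ {m} (d : Fin (suc m) → ℕ) → sumFin d ≡ d zero ℕ.+ sumFin (d ∘ suc)
  sumFin-suc {m} d = cong (λ ds → d zero ℕ.+ ℕL.sum ds) (trans (map-tabulate suc d) (sym (map-tabulate id (d ∘ suc))))

  sumFin-* : ∀ {m} j (d : Fin m → ℕ) → sumFin (λ i → j ℕ.* d i) ≡ j ℕ.* sumFin d
  sumFin-* {zero}  j d = sym (ℕₚ.*-zeroʳ j)
  sumFin-* {suc m} j d = begin
    sumFin (λ i → j ℕ.* d i)                       ≡⟨ sumFin-suc (λ i → j ℕ.* d i) ⟩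
    j ℕ.* d zero ℕ.+ sumFin (λ i → j ℕ.* d (suc i)) ≡⟨ cong (j ℕ.* d zero ℕ.+_) (sumFin-* j (d ∘ suc)) ⟩
    j ℕ.* d zero ℕ.+ j ℕ.* sumFin (d ∘ suc)        ≡⟨ sym (ℕₚ.*-distribˡ-+ j (d zero) _) ⟩
    j ℕ.* (d zero ℕ.+ sumFin (d ∘ suc))            ≡⟨ cong (j ℕ.*_) (sym (sumFin-suc d)) ⟩
    j ℕ.* sumFin d                                 ∎
    where open ≡-Reasoning

  degreeAtMost-product : ∀ {n m} (f : Fin m → Point n → Carrier) (d : Fin m → ℕ) → (∀ i → DegreeAtMost (d i) (f i)) →
                         DegreeAtMost (sumFin d) (λ a → product (λ i → f i a))
  degreeAtMost-product {m = zero}  f d f≤d = degreeAtMost-const 1#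
  degreeAtMost-product {m = suc m} f d f≤d = subst (λ D → DegreeAtMost D (λ a → product (λ i → f i a))) (sym (sumFin-suc d))
    (degreeAtMost-* (f≤d zero) (degreeAtMost-product (f ∘ suc) (d ∘ suc) (f≤d ∘ suc)))

  zeroIndicator : Carrier → Carrier
  zeroIndicator x = 1# + - 1# * pow x k

  zeroIndicator-0 : zeroIndicator 0# ≡ 1#
  zeroIndicator-0 = begin
    1# + - 1# * pow 0# k    ≡⟨ cong (λ y → 1# + - 1# * y) (pow-0 0<k) ⟩
    1# + - 1# * 0#          ≡⟨ cong (1# +_) (zeroʳ (- 1#)) ⟩
    1# + 0#                 ≡⟨ +-identityʳ 1# ⟩
    1#                      ∎
    where
    open ≡-Reasoning
    pow-0 : ∀ {j} → 0 < j → pow 0# j ≡ 0#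
    pow-0 {suc j} _ = zeroˡ _

  zeroIndicator-≢0 : ∀ {x} → x ≢ 0# → zeroIndicator x ≡ 0#
  zeroIndicator-≢0 {x} x≢0 = begin
    1# + - 1# * pow x k     ≡⟨ cong (λ y → 1# + - 1# * y) (fermat x x≢0) ⟩
    1# + - 1# * 1#          ≡⟨ cong (1# +_) (*-identityʳ (- 1#)) ⟩
    1# + - 1#               ≡⟨ -‿inverseʳ 1# ⟩
    0#                      ∎
    where open ≡-Reasoning

  degreeAtMost-zeroIndicator : ∀ {n D} {f : Point n → Carrier} → DegreeAtMost D f → DegreeAtMost (k ℕ.* D) (zeroIndicator ∘ f)
  degreeAtMost-zeroIndicator f≤D =
    degreeAtMost-+ (degreeAtMost-weaken z≤n (degreeAtMost-const 1#))
                   (degreeAtMost-* (degreeAtMost-const (- 1#)) (degreeAtMost-pow f≤D k))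

  commonZeroIndicator : ∀ {n m} → (Fin m → Polynomial n) → Point n → Carrier
  commonZeroIndicator P a = product (λ i → zeroIndicator (eval (P i) a))

  commonZeroIndicator-common-zero : ∀ {n m} (P : Fin m → Polynomial n) {a} → (∀ i → eval (P i) a ≡ 0#) →
                                    commonZeroIndicator P a ≡ 1#
  commonZeroIndicator-common-zero P {a} P[a]≡0 =
    product-one (λ i → zeroIndicator (eval (P i) a)) (λ i → trans (cong zeroIndicator (P[a]≡0 i)) zeroIndicator-0)

  commonZeroIndicator-nonzero : ∀ {n m} (P : Fin m → Polynomial n) {a} i → eval (P i) a ≢ 0# →
                                commonZeroIndicator P a ≡ 0#
  commonZeroIndicator-nonzero {m = suc m} P {a} i P[a]≢0 =
    product-zero (λ i → zeroIndicator (eval (P i) a)) i (zeroIndicator-≢0 P[a]≢0)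

  degreeAtMost-commonZeroIndicator : ∀ {n m} (P : Fin m → Polynomial n) (d : Fin m → ℕ) →
                                     (∀ i → DegreeAtMost (d i) (eval (P i))) →
                                     DegreeAtMost (k ℕ.* sumFin d) (commonZeroIndicator P)
  degreeAtMost-commonZeroIndicator P d P≤d = subst (λ D → DegreeAtMost D (commonZeroIndicator P)) (sumFin-* k d)
    (degreeAtMost-product (λ i → zeroIndicator ∘ eval (P i)) (λ i → k ℕ.* d i) (λ i → degreeAtMost-zeroIndicator (P≤d i)))

  -- Sums over T

  sumList : ∀ {n} → (Point n → Carrier) → List (Point n) → Carrier
  sumList f []       = 0#
  sumList f (t ∷ ts) = f t + sumList f ts

  sumList-cong : ∀ {n} {f g : Point n → Carrier} {ts} → All (λ t → f t ≡ g t) ts → sumList f ts ≡ sumList g ts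
  sumList-cong []            = refl
  sumList-cong (f≡g ∷ f≡gs) = cong₂ _+_ f≡g (sumList-cong f≡gs)

  sumList-zero : ∀ {n} {f : Point n → Carrier} {ts} → All (λ t → f t ≡ 0#) ts → sumList f ts ≡ 0#
  sumList-zero []            = refl
  sumList-zero (f≡0 ∷ f≡0s) = trans (cong₂ _+_ f≡0 (sumList-zero f≡0s)) (+-identityˡ 0#)

  sumList-separating : ∀ {n} (f : Point n → Carrier) ts → 1 ≤ length ts →
                       length (filter (λ t → f t ≟ᶠ 0#) ts) ≡ length ts ∸ 1 → sumList f ts ≢ 0#
  sumList-separating f (t ∷ ts) _ zeros with f t ≟ᶠ 0#
  sumList-separating f (t ∷ [])      _ () | yes _
  sumList-separating f (t ∷ t′ ∷ ts) _ zeros | yes f[t]≡0 = λ sum≡0 →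
    sumList-separating f (t′ ∷ ts) (s≤s z≤n) (ℕₚ.suc-injective zeros)
      (trans (sym (+-identityˡ _)) (trans (cong (_+ sumList f (t′ ∷ ts)) (sym f[t]≡0)) sum≡0))
  ... | no f[t]≢0 = λ sum≡0 → f[t]≢0 (begin
    f t                      ≡⟨ sym (+-identityʳ (f t)) ⟩
    f t + 0#                 ≡⟨ cong (f t +_) (sym (sumList-zero all-zeros)) ⟩
    f t + sumList f ts       ≡⟨ sum≡0 ⟩
    0#                       ∎)
    where
    open ≡-Reasoning
    all-zeros : All (λ t → f t ≡ 0#) ts
    all-zeros = subst (All _) (filter-complete (λ t → f t ≟ᶠ 0#) zeros) (all-filter (λ t → f t ≟ᶠ 0#) ts)

  separatingFunction : ∀ {n} (T : List (Point n)) → 1 ≤ length T → ∀ {r} → IsAlgComplexity T r →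
                       Σ (Point n → Carrier) λ G → DegreeAtMost r G × sumList G T ≢ 0#
  separatingFunction (t ∷ [])     _ (inj₁ (_ , refl)) =
    (λ _ → 1#) , degreeAtMost-const 1# , λ 1+0≡0 → 0≢1 (sym (trans (sym (+-identityʳ 1#)) 1+0≡0))
  separatingFunction (_ ∷ _ ∷ _) _ (inj₁ (() , _))
  separatingFunction T nonempty {r} (inj₂ (_ , (g , (g-deg , _) , separates) , _)) =
    eval g , coeff-vanishing-above⇒degreeAtMost g r g-deg , sumList-separating (eval g) T nonempty separates

  _≟ᴾ_ : ∀ {n} (a b : Point n) → Dec (a ≡ b)
  _≟ᴾ_ = ≡-dec _≟ᶠ_

  sumPoints-supported : ∀ n {T : List (Point n)} → Unique T → (f : Point n → Carrier) →
                        (∀ a → a ∉ T → f a ≡ 0#) → sumPoints n f ≡ sumList f T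
  sumPoints-supported n {[]}    _                f f≡0 = sumPoints-zero n f (λ a → f≡0 a (λ ()))
  sumPoints-supported n {t ∷ T} (t∉T ∷ unique) f f≡0 = begin
    sumPoints n f                              ≡⟨ sumPoints-cong n split ⟩
    sumPoints n (λ a → at-t a + off-t a)       ≡⟨ sumPoints-+ n at-t off-t ⟩
    sumPoints n at-t + sumPoints n off-t       ≡⟨ cong₂ _+_ (sumPoints-select n t at-t at-t-elsewhere) (sumPoints-supported n unique off-t off-t≡0) ⟩
    at-t t + sumList off-t T                   ≡⟨ cong₂ _+_ at-t-at-t (sumList-cong (All.map off-t-elsewhere t∉T)) ⟩
    f t + sumList f T                          ∎
    where
    open ≡-Reasoning
    at-t off-t : Point n → Carrier
    at-t a with a ≟ᴾ t
    ... | yes _ = f a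
    ... | no  _ = 0#
    off-t a with a ≟ᴾ t
    ... | yes _ = 0#
    ... | no  _ = f a

    split : ∀ a → f a ≡ at-t a + off-t a
    split a with a ≟ᴾ t
    ... | yes _ = sym (+-identityʳ (f a))
    ... | no  _ = sym (+-identityˡ (f a))

    at-t-at-t : at-t t ≡ f t
    at-t-at-t with t ≟ᴾ t
    ... | yes _   = refl
    ... | no  t≢t = contradiction refl t≢t

    at-t-elsewhere : ∀ a → a ≢ t → at-t a ≡ 0#
    at-t-elsewhere a a≢t with a ≟ᴾ t
    ... | yes a≡t = contradiction a≡t a≢t
    ... | no  _   = refl

    off-t-elsewhere : ∀ {a} → t ≢ a → off-t a ≡ f a
    off-t-elsewhere {a} t≢a with a ≟ᴾ t
    ... | yes a≡t = contradiction (sym a≡t) t≢a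
    ... | no  _   = refl

    off-t≡0 : ∀ a → a ∉ T → off-t a ≡ 0#
    off-t≡0 a a∉T with a ≟ᴾ t
    ... | yes _   = refl
    ... | no  a≢t = f≡0 a λ { (here a≡t) → a≢t a≡t ; (there a∈T) → a∉T a∈T }

  ∃-point? : ∀ n {p} {A : Point n → Set p} → Decidable A → Dec (∃ A)
  ∃-point? zero    A? with A? []
  ... | yes A[] = yes ([] , A[])
  ... | no ¬A[] = no λ { ([] , A[]) → ¬A[] A[] }
  ∃-point? (suc n) A? with any? (λ x → ∃-point? n (A? ∘ (x ∷_)))
  ... | yes (x , as , A[x∷as]) = yes (x ∷ as , A[x∷as])
  ... | no ∄x = no λ { (x ∷ as , A[x∷as]) → ∄x (x , as , A[x∷as]) }

  sumPoints-commonZeroIndicator : ∀ {n m} (P : Fin m → Polynomial n) {T} → Unique T → (G : Point n → Carrier) →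
                                  (∀ t → t ∈ T → ∀ i → eval (P i) t ≡ 0#) →
                                  ¬ (Σ (Point n) λ a → a ∉ T × (∀ i → eval (P i) a ≡ 0#)) →
                                  sumPoints n (λ a → commonZeroIndicator P a * G a) ≡ sumList G T
  sumPoints-commonZeroIndicator {n} {m} P {T} unique G T-zeros ∄a = begin
    sumPoints n (λ a → commonZeroIndicator P a * G a)   ≡⟨ sumPoints-supported n unique _ vanishes-off-T ⟩
    sumList (λ a → commonZeroIndicator P a * G a) T     ≡⟨ sumList-cong (All.tabulate λ {t} t∈T → agrees-on-T t t∈T) ⟩
    sumList G T                                         ∎
    where
    open ≡-Reasoning
    agrees-on-T : ∀ t → t ∈ T → commonZeroIndicator P t * G t ≡ G t
    agrees-on-T t t∈T = trans (cong (_* G t) (commonZeroIndicator-common-zero P (T-zeros t t∈T))) (*-identityˡ (G t))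
    vanishes-off-T : ∀ a → a ∉ T → commonZeroIndicator P a * G a ≡ 0#
    vanishes-off-T a a∉T with ¬∀⟶∃¬ m (λ i → eval (P i) a ≡ 0#) (λ i → eval (P i) a ≟ᶠ 0#) (λ common-zero → ∄a (a , a∉T , common-zero))
    ... | i , P[a]≢0 = trans (cong (_* G a) (commonZeroIndicator-nonzero P i P[a]≢0)) (zeroˡ (G a))

  commonZeroOutside? : ∀ {n m} (P : Fin m → Polynomial n) (T : List (Point n)) →
                       Dec (Σ (Point n) λ a → a ∉ T × (∀ i → eval (P i) a ≡ 0#))
  commonZeroOutside? {n} P T = ∃-point? n (λ a → ¬? (a ∈? T) ×-dec all? (λ i → eval (P i) a ≟ᶠ 0#))
    where open import Data.List.Membership.DecPropositional _≟ᴾ_ using (_∈?_)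

open import Data.Nat using (_+_; _*_)

corollary4p7 : (q n m : ℕ) (F : FiniteField q) →
    let open FiniteField F using (0#)
        open Poly F
    in (T : List (Point n)) → Unique T → 1 ≤ length T →
       (r : ℕ) → IsAlgComplexity T r →
       (P : Fin m → Polynomial n) (d : Fin m → ℕ) → (∀ i → IsDeg (P i) (d i)) →
       (∀ a → a ∈ T → ∀ i → eval (P i) a ≡ 0#) →
       (q ∸ 1) * sumFin d + r < (q ∸ 1) * n →
       Σ (Point n) λ a → a ∉ T × (∀ i → eval (P i) a ≡ 0#)
corollary4p7 zero n m F with () ← FiniteField.0# F
corollary4p7 (suc k) n m F T unique nonempty r complexity P d degree T-zeros bound =
  decidable-stable (commonZeroOutside? P T) λ ∄a →
    let G , G≤r , ∑G≢0 = separatingFunction T nonempty complexity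
    in ∑G≢0 (trans (sym (sumPoints-commonZeroIndicator P unique G T-zeros ∄a))
                   (sumPoints-degreeAtMost (degreeAtMost-* χ≤ G≤r) bound))
  where
  open ChevalleyWarning F
  open Poly F using (sumFin)
  χ≤ : DegreeAtMost (k * sumFin d) (commonZeroIndicator P)
  χ≤ = degreeAtMost-commonZeroIndicator P d (λ i → coeff-vanishing-above⇒degreeAtMost (P i) (d i) (proj₁ (degree i)))
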